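{- Let $v\in S_n$ and let $I$ be any hypercube decomposition of $[e,v]$. If $(i\,j)\in\mathcal{Y}_e$ with $i<j$, then for every $k$ with $i<k<j$, exactly one of $(i\,k)$ and $(k\,j)$ lies in $\mathcal{Y}_e$.
   Context: $S_n$: symmetric group, $e$ identity, length $\ell$. Bruhat graph: edge $x\to y$ when $yx^{ -1}$ is a transposition and $\ell(x)<\ell(y)$; Bruhat order $x\le y$ iff a directed path exists; $\Gamma(e,v)$ induced subgraph on $[e,v]$. Hypercubes in $\Gamma(e,v)$: subgraphs isomorphic to upward directed Hasse diagrams of Boolean lattices, spanned by the endpoints of edges leaving the bottom; diamond = $2$-hypercube; $I$ diamond-closed if it contains the fourth vertex of each diamond of $\Gamma(e,v)$ of which it contains three. For $x\in I$: $\mathcal{Y}_x=\{y\in[e,v]\setminus I: x\to y\}$, $\mathcal{A}_x$ = antichains of $(\mathcal{Y}_x,\le)$. Hypercube cluster at $x$: for each $Y\in\mathcal{A}_x$ there is a unique hypercube in $\Gamma(e,v)$ with bottom $x$ spanned by $Y$. A hypercube decomposition of $[e,v]$: $I=[e,z]$ for some $z\in[e,v]$, diamond-closed, with a hypercube cluster at every $x\in I$. -}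

module Defs where

open import Data.Nat as ℕ using (ℕ)
open import Data.Fin as F using (Fin; _≟_; _<?_)
open import Data.Fin.Subset using (Subset; ⁅_⁆; _∪_; _∉_) renaming (⊥ to ∅)
open import Data.Vec using (Vec; lookup; map; allFin)
open import Data.List as L using (List; length; filter; cartesianProduct)
open import Data.List.Relation.Unary.All using (All)
open import Data.List.Relation.Unary.AllPairs using (AllPairs)
open import Data.Product using (Σ; ∃; ∃-syntax; _×_; _,_)
open import Data.Sum using (_⊎_)
open import Relation.Nullary using (¬_; yes; no)
open import Relation.Nullary.Decidable using (_×-dec_)
open import Relation.Binary.PropositionalEquality using (_≡_; _≢_)
open import Relation.Binary.Construct.Closure.ReflexiveTransitive using (Star)

Perm : ℕ → Set
Perm n = Vec (Fin n) n

IsPerm : ∀ {n} → Perm n → Set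
IsPerm v = ∀ a b → lookup v a ≡ lookup v b → a ≡ b

e : ∀ {n} → Perm n
e = allFin _

swap : ∀ {n} → Fin n → Fin n → Fin n → Fin n
swap a b c with c ≟ a
... | yes _ = b
... | no _ with c ≟ b
...   | yes _ = a
...   | no _ = c

-- left multiplication t ∘ x by the transposition t = (a b)
tmul : ∀ {n} → Fin n → Fin n → Perm n → Perm n
tmul a b x = map (swap a b) x

transp : ∀ {n} → Fin n → Fin n → Perm n
transp a b = tmul a b e

len : ∀ {n} → Perm n → ℕ
len {n} x = length (filter (λ p → Data.Product.proj₁ p <? Data.Product.proj₂ p
                                 ×-dec lookup x (Data.Product.proj₂ p) <? lookup x (Data.Product.proj₁ p))
                           (cartesianProduct (L.allFin n) (L.allFin n)))

Edge : ∀ {n} → Perm n → Perm n → Set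
Edge {n} x y = (Σ (Fin n) λ a → Σ (Fin n) λ b → a ≢ b × y ≡ tmul a b x) × len x ℕ.< len y

_≤B_ : ∀ {n} → Perm n → Perm n → Set
x ≤B y = Star Edge x y

InInt : ∀ {n} → Perm n → Perm n → Set
InInt v x = e ≤B x × x ≤B v

-- Its image (with these edges) is a subgraph isomorphic to the upward
-- Hasse diagram of the Boolean lattice; bottom = φ ∅, atoms = φ {i}.
IsCube : ∀ {n} → Perm n → (k : ℕ) → (Subset k → Perm n) → Set
IsCube v k φ =
  (∀ S T → φ S ≡ φ T → S ≡ T) ×
  (∀ S → InInt v (φ S)) ×
  (∀ S i → i ∉ S → Edge (φ S) (φ (⁅ i ⁆ ∪ S)))

CubeAt : ∀ {n} → Perm n → Perm n → (Y : List (Perm n)) → (Subset (length Y) → Perm n) → Set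
CubeAt v x Y φ = IsCube v (length Y) φ × φ ∅ ≡ x × (∀ i → φ ⁅ i ⁆ ≡ L.lookup Y i)

InI : ∀ {n} → Perm n → Perm n → Set
InI z x = e ≤B x × x ≤B z

InY : ∀ {n} → Perm n → Perm n → Perm n → Perm n → Set
InY v z x y = InInt v y × ¬ InI z y × Edge x y

-- antichains of (𝒴_x, ≤), as duplicate-free lists
Antichain : ∀ {n} → Perm n → Perm n → Perm n → List (Perm n) → Set
Antichain v z x Y = All (InY v z x) Y × AllPairs (λ a b → ¬ a ≤B b × ¬ b ≤B a) Y

DiamondClosed : ∀ {n} → Perm n → Perm n → Set
DiamondClosed v z = ∀ φ → IsCube v 2 φ → ∀ S → (∀ T → T ≢ S → InI z (φ T)) → InI z (φ S)

HypercubeCluster : ∀ {n} → Perm n → Perm n → Perm n → Set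
HypercubeCluster {n} v z x = ∀ Y → Antichain v z x Y →
  Σ (Subset (length Y) → Perm n) λ φ → CubeAt v x Y φ × (∀ ψ → CubeAt v x Y ψ → ∀ S → ψ S ≡ φ S)

-- I = [e,z] is a hypercube decomposition of [e,v]
HypercubeDecomposition : ∀ {n} → Perm n → Perm n → Set
HypercubeDecomposition v z = InInt v z × DiamondClosed v z × (∀ x → InI z x → HypercubeCluster v z x)

-- Write tik = (i k), tkj = (k j), tij = (i j).  The interval [e, tij] also contains the
-- products (i j)(i k) and (k j)(i k), and its eight edges (from e to tik and tkj, from these
-- to both products, from the products to tij) form three diamonds: two with bottom e and top
-- one of the products, and one with bottom tik and top tij.  If tik and tkj both lay in I,
-- diamond-closedness would push both products and then tij into I.  If neither did,
-- {tik, tkj} would be an antichain of 𝒴_e spanning two distinct diamonds with bottom e,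
-- against the uniqueness in the hypercube cluster at e.  That tik and tkj are incomparable
-- follows from the Bruhat-monotone statistic "some position ≤ A carries a value ≥ B".
-- The case distinction is effective because the Bruhat order is decidable: a path from x
-- to y has at most len y edges.
module Submission where

open import Defs
open import Data.Bool using (true; false)
open import Data.Empty using (⊥; ⊥-elim)
open import Data.Fin using (Fin; zero; suc; _<_; _≤_; _≟_; _<?_; _≤?_)
import Data.Fin.Properties as Finₚ
open import Data.Fin.Subset using (Subset; ⁅_⁆; _∪_; _∉_)
open import Data.List as List using (List; []; _∷_; length; filter; cartesianProduct)
open import Data.List.Membership.Propositional using (_∈_)
import Data.List.Membership.Propositional.Properties as ∈ₚ
open import Data.List.Membership.Propositional.Properties.WithK using (unique∧set⇒bag)
import Data.List.Properties as Listₚ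
open import Data.List.Relation.Binary.BagAndSetEquality using (∼bag⇒↭)
open import Data.List.Relation.Binary.Permutation.Propositional using (_↭_)
import Data.List.Relation.Binary.Permutation.Propositional.Properties as ↭ₚ
open import Data.List.Relation.Unary.All using () renaming ([] to []ᴬ; _∷_ to _∷ᴬ_)
open import Data.List.Relation.Unary.AllPairs using () renaming ([] to []ᴾ; _∷_ to _∷ᴾ_)
open import Data.List.Relation.Unary.Any using (here; there)
open import Data.List.Relation.Unary.Unique.Propositional using (Unique)
import Data.List.Relation.Unary.Unique.Propositional.Properties as Uniqueₚ
open import Data.Nat as ℕ using (ℕ; zero; suc)
import Data.Nat.Properties as ℕₚ
open import Data.Product using (∃-syntax; _×_; _,_; proj₁; proj₂)
open import Data.Sum using (_⊎_; inj₁; inj₂)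
open import Data.Vec using (lookup; []; _∷_)
import Data.Vec.Base as Vec
import Data.Vec.Properties as Vecₚ
open import Function using (_∘_; mk⇔)
open import Level using (0ℓ)
open import Relation.Binary.Construct.Closure.ReflexiveTransitive using (ε; _◅_; _◅◅_)
open import Relation.Binary.Definitions using (tri<; tri≈; tri>)
open import Relation.Binary.PropositionalEquality
  using (_≡_; _≢_; refl; sym; trans; cong; cong₂; subst; subst₂; module ≡-Reasoning)
open import Relation.Nullary using (¬_; Dec; yes; no)
open import Relation.Nullary.Decidable using (_×-dec_; ¬?; map′)
open import Relation.Unary using (Pred; Decidable)

private variable
  n N : ℕ
  x y w : Perm n

swap-fst : (a b : Fin n) → swap a b a ≡ b
swap-fst a b with a ≟ a
... | yes _ = refl
... | no a≢a = ⊥-elim (a≢a refl)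

swap-snd : (a b : Fin n) → swap a b b ≡ a
swap-snd a b with b ≟ a
... | yes b≡a = b≡a
... | no _ with b ≟ b
...   | yes _ = refl
...   | no b≢b = ⊥-elim (b≢b refl)

swap-other : (a b : Fin n) {c : Fin n} → c ≢ a → c ≢ b → swap a b c ≡ c
swap-other a b {c} c≢a c≢b with c ≟ a
... | yes c≡a = ⊥-elim (c≢a c≡a)
... | no _ with c ≟ b
...   | yes c≡b = ⊥-elim (c≢b c≡b)
...   | no _ = refl

swap-involutive : (a b c : Fin n) → swap a b (swap a b c) ≡ c
swap-involutive a b c with c ≟ a
... | yes c≡a = trans (swap-snd a b) (sym c≡a)
... | no c≢a with c ≟ b
...   | yes c≡b = trans (swap-fst a b) (sym c≡b)
...   | no c≢b = swap-other a b c≢a c≢b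

swap-comm : (a b c : Fin n) → swap a b c ≡ swap b a c
swap-comm a b c = cases (c ≟ a) (c ≟ b)
  where
  cases : Dec (c ≡ a) → Dec (c ≡ b) → swap a b c ≡ swap b a c
  cases (yes refl) _ = trans (swap-fst c b) (sym (swap-snd b c))
  cases (no _) (yes refl) = trans (swap-snd a c) (sym (swap-fst c a))
  cases (no c≢a) (no c≢b) = trans (swap-other a b c≢a c≢b) (sym (swap-other b a c≢b c≢a))

lookup-ext : (x y : Perm n) → (∀ m → lookup x m ≡ lookup y m) → x ≡ y
lookup-ext x y x≗y =
  trans (sym (Vecₚ.tabulate∘lookup x)) (trans (Vecₚ.tabulate-cong x≗y) (Vecₚ.tabulate∘lookup y))

lookup-e : (m : Fin n) → lookup e m ≡ m
lookup-e = Vecₚ.lookup-allFin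

lookup-tmul : (a b : Fin n) (x : Perm n) (m : Fin n) → lookup (tmul a b x) m ≡ swap a b (lookup x m)
lookup-tmul a b x m = Vecₚ.lookup-map m (swap a b) x

lookup-tmul-fst : ∀ {a} b (x : Perm n) m → lookup x m ≡ a → lookup (tmul a b x) m ≡ b
lookup-tmul-fst {a = a} b x m x[m]≡a =
  trans (lookup-tmul a b x m) (trans (cong (swap a b) x[m]≡a) (swap-fst a b))

lookup-tmul-snd : ∀ a {b} (x : Perm n) m → lookup x m ≡ b → lookup (tmul a b x) m ≡ a
lookup-tmul-snd a {b} x m x[m]≡b =
  trans (lookup-tmul a b x m) (trans (cong (swap a b) x[m]≡b) (swap-snd a b))

tmul-involutive : (a b : Fin n) (x : Perm n) → tmul a b (tmul a b x) ≡ x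
tmul-involutive a b x =
  trans (sym (Vecₚ.map-∘ (swap a b) (swap a b) x))
        (trans (Vecₚ.map-cong (swap-involutive a b) x) (Vecₚ.map-id x))

tmul-comm : (a b : Fin n) (x : Perm n) → tmul a b x ≡ tmul b a x
tmul-comm a b = Vecₚ.map-cong (swap-comm a b)

IsOnto : Perm n → Set
IsOnto {n} x = ∀ c → ∃[ m ] lookup x m ≡ c

IsPerm-e : IsPerm (e {n})
IsPerm-e a b eq = trans (sym (lookup-e a)) (trans eq (lookup-e b))

IsOnto-e : IsOnto (e {n})
IsOnto-e c = c , lookup-e c

IsPerm-tmul : (a b : Fin n) (x : Perm n) → IsPerm x → IsPerm (tmul a b x)
IsPerm-tmul a b x x-perm c d eq = x-perm c d (begin
  lookup x c                        ≡⟨ swap-involutive a b _ ⟨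
  swap a b (swap a b (lookup x c))  ≡⟨ cong (swap a b) (lookup-tmul a b x c) ⟨
  swap a b (lookup (tmul a b x) c)  ≡⟨ cong (swap a b) eq ⟩
  swap a b (lookup (tmul a b x) d)  ≡⟨ cong (swap a b) (lookup-tmul a b x d) ⟩
  swap a b (swap a b (lookup x d))  ≡⟨ swap-involutive a b _ ⟩
  lookup x d                        ∎)
  where open ≡-Reasoning

IsOnto-tmul : (a b : Fin n) (x : Perm n) → IsOnto x → IsOnto (tmul a b x)
IsOnto-tmul a b x x-onto c with x-onto (swap a b c)
... | m , x[m]≡ =
  m , trans (lookup-tmul a b x m) (trans (cong (swap a b) x[m]≡) (swap-involutive a b c))

IsPerm-edge : (x : Perm n) → Edge x y → IsPerm x → IsPerm y
IsPerm-edge x ((a , b , _ , refl) , _) = IsPerm-tmul a b x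

IsOnto-edge : (x : Perm n) → Edge x y → IsOnto x → IsOnto y
IsOnto-edge x ((a , b , _ , refl) , _) = IsOnto-tmul a b x

edge⇒≢ : Edge x y → x ≢ y
edge⇒≢ (_ , longer) x≡y = ℕₚ.<-irrefl (cong len x≡y) longer

≤B⇒len≤ : x ≤B y → len x ℕ.≤ len y
≤B⇒len≤ ε = ℕₚ.≤-refl
≤B⇒len≤ ((_ , longer) ◅ w≤y) = ℕₚ.≤-trans (ℕₚ.<⇒≤ longer) (≤B⇒len≤ w≤y)

module _ {A : Set} where

  count : {P : Pred A 0ℓ} → Decidable P → List A → ℕ
  count P? xs = length (filter P? xs)

  count-mono : {P Q : Pred A 0ℓ} (P? : Decidable P) (Q? : Decidable Q) (xs : List A) →
    (∀ {u} → P u → Q u) → count P? xs ℕ.≤ count Q? xs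
  count-mono P? Q? [] P⇒Q = ℕ.z≤n
  count-mono P? Q? (u ∷ xs) P⇒Q with P? u | Q? u
  ... | yes _ | yes _ = ℕ.s≤s (count-mono P? Q? xs P⇒Q)
  ... | yes Pu | no ¬Qu = ⊥-elim (¬Qu (P⇒Q Pu))
  ... | no _ | yes _ = ℕₚ.m≤n⇒m≤1+n (count-mono P? Q? xs P⇒Q)
  ... | no _ | no _ = count-mono P? Q? xs P⇒Q

  count-< : {P Q : Pred A 0ℓ} (P? : Decidable P) (Q? : Decidable Q) (xs : List A) →
    (∀ {u} → P u → Q u) → ∀ {w} → w ∈ xs → Q w → ¬ P w → count P? xs ℕ.< count Q? xs
  count-< P? Q? (u ∷ xs) P⇒Q (here refl) Qw ¬Pw with P? u | Q? u
  ... | yes Pu | _ = ⊥-elim (¬Pw Pu)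
  ... | no _ | yes _ = ℕ.s≤s (count-mono P? Q? xs P⇒Q)
  ... | no _ | no ¬Qu = ⊥-elim (¬Qu Qw)
  count-< P? Q? (u ∷ xs) P⇒Q (there w∈xs) Qw ¬Pw with P? u | Q? u
  ... | yes _ | yes _ = ℕ.s≤s (count-< P? Q? xs P⇒Q w∈xs Qw ¬Pw)
  ... | yes Pu | no ¬Qu = ⊥-elim (¬Qu (P⇒Q Pu))
  ... | no _ | yes _ = ℕₚ.m≤n⇒m≤1+n (count-< P? Q? xs P⇒Q w∈xs Qw ¬Pw)
  ... | no _ | no _ = count-< P? Q? xs P⇒Q w∈xs Qw ¬Pw

  count-map : {P : Pred A 0ℓ} (P? : Decidable P) (g : A → A) (xs : List A) →
    count P? (List.map g xs) ≡ count (P? ∘ g) xs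
  count-map P? g [] = refl
  count-map P? g (u ∷ xs) with P? (g u)
  ... | yes _ = cong suc (count-map P? g xs)
  ... | no _ = count-map P? g xs

  count-involution : {P : Pred A 0ℓ} (P? : Decidable P) (g : A → A) (xs : List A) → Unique xs →
    (∀ u → u ∈ xs) → (∀ u → g (g u) ≡ u) → count P? xs ≡ count (P? ∘ g) xs
  count-involution P? g xs xs-unique complete g-involutive =
    trans (↭ₚ.↭-length (↭ₚ.filter-↭ P? xs↭gxs)) (count-map P? g xs)
    where
    g-injective : ∀ {u w} → g u ≡ g w → u ≡ w
    g-injective {u} {w} eq = trans (sym (g-involutive u)) (trans (cong g eq) (g-involutive w))
    xs↭gxs : xs ↭ List.map g xs
    xs↭gxs = ∼bag⇒↭ (unique∧set⇒bag xs-unique (Uniqueₚ.map⁺ g-injective xs-unique)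
      (λ {u} → mk⇔ (λ _ → subst (_∈ List.map g xs) (g-involutive u) (∈ₚ.∈-map⁺ g (complete (g u))))
                   (λ _ → complete u)))

-- Inversions, and the length of a swap of values

Pair : ℕ → Set
Pair n = Fin n × Fin n

pairs : (n : ℕ) → List (Pair n)
pairs n = cartesianProduct (List.allFin n) (List.allFin n)

∈-pairs : (u : Pair n) → u ∈ pairs n
∈-pairs (r , s) = ∈ₚ.∈-cartesianProduct⁺ (∈ₚ.∈-allFin r) (∈ₚ.∈-allFin s)

pairs-unique : (n : ℕ) → Unique (pairs n)
pairs-unique n = Uniqueₚ.cartesianProduct⁺ (Uniqueₚ.allFin⁺ n) (Uniqueₚ.allFin⁺ n)

Inversion : Perm n → Pred (Pair n) 0ℓ
Inversion x u = proj₁ u < proj₂ u × lookup x (proj₂ u) < lookup x (proj₁ u)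

-- len x is, by definition, count (inversion? x) (pairs n).
inversion? : (x : Perm n) → Decidable (Inversion x)
inversion? x u = proj₁ u <? proj₂ u ×-dec lookup x (proj₂ u) <? lookup x (proj₁ u)

len≤ : (x : Perm n) → len x ℕ.≤ length (pairs n)
len≤ {n} x = Listₚ.length-filter (inversion? x) (pairs n)

-- With x′ = x ∘ (p q), let g apply (p q) to both entries of the pairs whose order that keeps,
-- and fix the other pairs.  Then g is an involution on pairs sending the inversions of x into
-- those of x′, and (p , q) is a new inversion.
module _ (x : Perm n) (x-perm : IsPerm x) (p q : Fin n) (p<q : p < q) {α β : Fin n}
         (x[p]≡α : lookup x p ≡ α) (x[q]≡β : lookup x q ≡ β) (α<β : α < β) where

  private
    τ : Fin n → Fin n
    τ = swap p q

    x′ : Perm n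
    x′ = tmul α β x

    x[p]<x[q] : lookup x p < lookup x q
    x[p]<x[q] = subst₂ _<_ (sym x[p]≡α) (sym x[q]≡β) α<β

    x′≗x∘τ : ∀ m → lookup x′ m ≡ lookup x (τ m)
    x′≗x∘τ m = cases (m ≟ p) (m ≟ q)
      where
      cases : Dec (m ≡ p) → Dec (m ≡ q) → lookup x′ m ≡ lookup x (τ m)
      cases (yes refl) _ =
        trans (lookup-tmul-fst β x p x[p]≡α) (trans (sym x[q]≡β) (cong (lookup x) (sym (swap-fst m q))))
      cases (no _) (yes refl) =
        trans (lookup-tmul-snd α x q x[q]≡β) (trans (sym x[p]≡α) (cong (lookup x) (sym (swap-snd p m))))
      cases (no m≢p) (no m≢q) =
        trans (lookup-tmul α β x m)
              (trans (swap-other α β (λ eq → m≢p (x-perm m p (trans eq (sym x[p]≡α))))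
                                     (λ eq → m≢q (x-perm m q (trans eq (sym x[q]≡β)))))
                     (cong (lookup x) (sym (swap-other p q m≢p m≢q))))

    x′∘τ≗x : ∀ m → lookup x′ (τ m) ≡ lookup x m
    x′∘τ≗x m = trans (x′≗x∘τ (τ m)) (cong (lookup x) (swap-involutive p q m))

    reversed-inversion-persists : ∀ r s → r < s → ¬ τ r < τ s →
      lookup x s < lookup x r → lookup x (τ s) < lookup x (τ r)
    reversed-inversion-persists r s r<s τr≮τs x[s]<x[r] = cases (r ≟ p) (r ≟ q) (s ≟ p) (s ≟ q)
      where
      cases : Dec (r ≡ p) → Dec (r ≡ q) → Dec (s ≡ p) → Dec (s ≡ q) → lookup x (τ s) < lookup x (τ r)
      cases (yes refl) _ (yes refl) _ = ⊥-elim (ℕₚ.<-irrefl refl r<s)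
      cases (yes refl) _ _ (yes refl) = ⊥-elim (ℕₚ.<-asym x[s]<x[r] x[p]<x[q])
      cases (yes refl) _ (no s≢p) (no s≢q) =
        subst₂ (λ c d → lookup x c < lookup x d) (sym (swap-other p q s≢p s≢q)) (sym (swap-fst r q))
               (ℕₚ.<-trans x[s]<x[r] x[p]<x[q])
      cases (no _) (yes refl) (yes refl) _ = ⊥-elim (ℕₚ.<-asym p<q r<s)
      cases (no _) (yes refl) _ (yes refl) = ⊥-elim (ℕₚ.<-irrefl refl r<s)
      cases (no _) (yes refl) (no s≢p) (no s≢q) =
        ⊥-elim (τr≮τs (subst₂ _<_ (sym (swap-snd p r)) (sym (swap-other p q s≢p s≢q))
                              (ℕₚ.<-trans p<q r<s)))
      cases (no r≢p) (no r≢q) (yes refl) _ =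
        ⊥-elim (τr≮τs (subst₂ _<_ (sym (swap-other p q r≢p r≢q)) (sym (swap-fst s q))
                              (ℕₚ.<-trans r<s p<q)))
      cases (no r≢p) (no r≢q) (no _) (yes refl) =
        subst₂ (λ c d → lookup x c < lookup x d) (sym (swap-snd p s)) (sym (swap-other p q r≢p r≢q))
               (ℕₚ.<-trans x[p]<x[q] x[s]<x[r])
      cases (no r≢p) (no r≢q) (no s≢p) (no s≢q) =
        ⊥-elim (τr≮τs (subst₂ _<_ (sym (swap-other p q r≢p r≢q)) (sym (swap-other p q s≢p s≢q))
                              r<s))

    Kept : Pred (Pair n) 0ℓ
    Kept (r , s) = r < s × τ r < τ s

    kept? : Decidable Kept
    kept? (r , s) = r <? s ×-dec τ r <? τ s

    τ² : Pair n → Pair n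
    τ² (r , s) = τ r , τ s

    τ²-involutive : ∀ u → τ² (τ² u) ≡ u
    τ²-involutive (r , s) = cong₂ _,_ (swap-involutive p q r) (swap-involutive p q s)

    Kept-τ² : ∀ {u} → Kept u → Kept (τ² u)
    Kept-τ² {r , s} (r<s , τr<τs) =
      τr<τs , subst₂ _<_ (sym (swap-involutive p q r)) (sym (swap-involutive p q s)) r<s

    g : Pair n → Pair n
    g u with kept? u
    ... | yes _ = τ² u
    ... | no _ = u

    g-kept : ∀ {u} → Kept u → g u ≡ τ² u
    g-kept {u} k with kept? u
    ... | yes _ = refl
    ... | no ¬k = ⊥-elim (¬k k)

    g-unkept : ∀ {u} → ¬ Kept u → g u ≡ u
    g-unkept {u} ¬k with kept? u
    ... | yes k = ⊥-elim (¬k k)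
    ... | no _ = refl

    g-involutive : ∀ u → g (g u) ≡ u
    g-involutive u = cases (kept? u)
      where
      cases : Dec (Kept u) → g (g u) ≡ u
      cases (yes k) = trans (cong g (g-kept k)) (trans (g-kept (Kept-τ² k)) (τ²-involutive u))
      cases (no ¬k) = trans (cong g (g-unkept ¬k)) (g-unkept ¬k)

    g-inversion : ∀ {u} → Inversion x u → Inversion x′ (g u)
    g-inversion {u@(r , s)} (r<s , x[s]<x[r]) = cases (kept? u)
      where
      cases : Dec (Kept u) → Inversion x′ (g u)
      cases (yes k@(_ , τr<τs)) =
        subst (Inversion x′) (sym (g-kept k))
          (τr<τs , subst₂ _<_ (sym (x′∘τ≗x s)) (sym (x′∘τ≗x r)) x[s]<x[r])
      cases (no ¬k) =
        subst (Inversion x′) (sym (g-unkept ¬k))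
          (r<s , subst₂ _<_ (sym (x′≗x∘τ s)) (sym (x′≗x∘τ r))
                        (reversed-inversion-persists r s r<s (λ τr<τs → ¬k (r<s , τr<τs)) x[s]<x[r]))

    pq-reversed : ¬ Kept (p , q)
    pq-reversed (_ , τp<τq) = ℕₚ.<-asym p<q (subst₂ _<_ (swap-fst p q) (swap-snd p q) τp<τq)

    pq-new-inversion : Inversion x′ (g (p , q))
    pq-new-inversion = subst (Inversion x′) (sym (g-unkept pq-reversed))
      (p<q , subst₂ _<_ (sym (lookup-tmul-snd α x q x[q]≡β)) (sym (lookup-tmul-fst β x p x[p]≡α)) α<β)

    pq-not-inversion : ¬ Inversion x (p , q)
    pq-not-inversion (_ , x[q]<x[p]) = ℕₚ.<-asym x[q]<x[p] x[p]<x[q]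

  ascending-swap-lengthens : len x ℕ.< len (tmul α β x)
  ascending-swap-lengthens = begin-strict
    count (inversion? x) (pairs n)
      <⟨ count-< (inversion? x) (inversion? x′ ∘ g) (pairs n) g-inversion (∈-pairs (p , q))
                 pq-new-inversion pq-not-inversion ⟩
    count (inversion? x′ ∘ g) (pairs n)
      ≡⟨ count-involution (inversion? x′) g (pairs n) (pairs-unique n) ∈-pairs g-involutive ⟨
    count (inversion? x′) (pairs n) ∎
    where open ℕₚ.≤-Reasoning

ascending-edge : ∀ (x : Perm n) (p q : Fin n) {α β} → IsPerm x → p < q →
  lookup x p ≡ α → lookup x q ≡ β → α < β → Edge x (tmul α β x)
ascending-edge x p q x-perm p<q x[p]≡α x[q]≡β α<β =
  (_ , _ , Finₚ.<⇒≢ α<β , refl) , ascending-swap-lengthens x x-perm p q p<q x[p]≡α x[q]≡β α<β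

lengthening-swap-is-ascending : ∀ (x : Perm n) {a b} (q r : Fin n) → IsPerm x →
  len x ℕ.< len (tmul a b x) → lookup x r ≡ a → lookup x q ≡ b → b < a → q < r
lengthening-swap-is-ascending x {a} {b} q r x-perm longer x[r]≡a x[q]≡b b<a
  with Finₚ.<-cmp q r
... | tri< q<r _ _ = q<r
... | tri≈ _ refl _ = ⊥-elim (Finₚ.<⇒≢ b<a (trans (sym x[q]≡b) x[r]≡a))
... | tri> _ _ r<q =
  ⊥-elim (ℕₚ.<-asym longer (subst (λ t → len (tmul a b x) ℕ.< len t) swapped-back shorter))
  where
  shorter : len (tmul a b x) ℕ.< len (tmul b a (tmul a b x))
  shorter = ascending-swap-lengthens (tmul a b x) (IsPerm-tmul a b x x-perm) r q r<q
              (lookup-tmul-fst b x r x[r]≡a) (lookup-tmul-snd a x q x[q]≡b) b<a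
  swapped-back : tmul b a (tmul a b x) ≡ x
  swapped-back = trans (tmul-comm b a (tmul a b x)) (tmul-involutive a b x)

-- Decidability of the Bruhat order

data Path≤ {n : ℕ} : ℕ → Perm n → Perm n → Set where
  stay : Path≤ N x x
  step : Edge x w → Path≤ N w y → Path≤ (suc N) x y

Path≤⇒≤B : Path≤ N x y → x ≤B y
Path≤⇒≤B stay = ε
Path≤⇒≤B (step x→w w⇝y) = x→w ◅ Path≤⇒≤B w⇝y

≤B⇒Path≤ : ∀ {N} {x y : Perm n} → x ≤B y → len y ℕ.≤ N ℕ.+ len x → Path≤ N x y
≤B⇒Path≤ ε _ = stay
≤B⇒Path≤ {N = zero} (x→w ◅ w≤y) bound =
  ⊥-elim (ℕₚ.<-irrefl refl (ℕₚ.<-≤-trans (ℕₚ.<-≤-trans (proj₂ x→w) (≤B⇒len≤ w≤y)) bound))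
≤B⇒Path≤ {N = suc N} {x = x} {y = y} (x→w ◅ w≤y) bound =
  step x→w (≤B⇒Path≤ w≤y (ℕₚ.≤-trans (subst (len y ℕ.≤_) (sym (ℕₚ.+-suc N (len x))) bound)
                                    (ℕₚ.+-monoʳ-≤ N (proj₂ x→w))))

Path≤? : ∀ N (x y : Perm n) → Dec (Path≤ N x y)
Path≤? N x y with Vecₚ.≡-dec _≟_ x y
... | yes refl = yes stay
Path≤? zero x y | no x≢y = no λ { stay → x≢y refl }
Path≤? (suc N) x y | no x≢y =
  map′ (λ (a , b , a≢b , longer , w⇝y) → step ((a , b , a≢b , refl) , longer) w⇝y) first-step
       (Finₚ.any? λ a → Finₚ.any? λ b →
          ¬? (a ≟ b) ×-dec len x ℕ.<? len (tmul a b x) ×-dec Path≤? N (tmul a b x) y)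
  where
  first-step : Path≤ (suc N) x y →
    ∃[ a ] ∃[ b ] a ≢ b × len x ℕ.< len (tmul a b x) × Path≤ N (tmul a b x) y
  first-step stay = ⊥-elim (x≢y refl)
  first-step (step ((a , b , a≢b , refl) , longer) w⇝y) = a , b , a≢b , longer , w⇝y

_≤B?_ : (x y : Perm n) → Dec (x ≤B y)
_≤B?_ {n} x y = map′ Path≤⇒≤B (λ x≤y → ≤B⇒Path≤ x≤y (ℕₚ.≤-trans (len≤ y) (ℕₚ.m≤m+n _ _)))
                     (Path≤? (length (pairs n)) x y)

-- A Bruhat-monotone statistic

record PrefixReaches (A B : Fin n) (x : Perm n) : Set where
  constructor reach
  field
    position : Fin n
    position≤A : position ≤ A
    B≤value : B ≤ lookup x position

module _ {A B : Fin n} where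

  private
    swap-away-from : ∀ (x : Perm n) {a} b → IsPerm x → IsOnto x → len x ℕ.< len (tmul a b x) →
      ∀ r → lookup x r ≡ a → r ≤ A → B ≤ a → PrefixReaches A B (tmul a b x)
    swap-away-from x {a} b x-perm x-onto longer r x[r]≡a r≤A B≤a with B ≤? b | x-onto b
    ... | yes B≤b | _ = reach r r≤A (subst (B ≤_) (sym (lookup-tmul-fst b x r x[r]≡a)) B≤b)
    ... | no B≰b | q , x[q]≡b =
      reach q (Finₚ.≤-trans (ℕₚ.<⇒≤ q<r) r≤A) (subst (B ≤_) (sym (lookup-tmul-snd a x q x[q]≡b)) B≤a)
      where
      q<r : q < r
      q<r = lengthening-swap-is-ascending x q r x-perm longer x[r]≡a x[q]≡b
              (ℕₚ.<-≤-trans (ℕₚ.≰⇒> B≰b) B≤a)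

  PrefixReaches-edge : (x : Perm n) → IsPerm x → IsOnto x → Edge x y →
    PrefixReaches A B x → PrefixReaches A B y
  PrefixReaches-edge x x-perm x-onto ((a , b , _ , refl) , longer) (reach r r≤A B≤x[r])
    with lookup x r ≟ a | lookup x r ≟ b
  ... | yes x[r]≡a | _ =
    swap-away-from x b x-perm x-onto longer r x[r]≡a r≤A (subst (B ≤_) x[r]≡a B≤x[r])
  ... | no _ | yes x[r]≡b =
    subst (PrefixReaches A B) (tmul-comm b a x)
      (swap-away-from x a x-perm x-onto (subst (λ t → len x ℕ.< len t) (tmul-comm a b x) longer)
                      r x[r]≡b r≤A (subst (B ≤_) x[r]≡b B≤x[r]))
  ... | no x[r]≢a | no x[r]≢b =
    reach r r≤A (subst (B ≤_) (sym (trans (lookup-tmul a b x r) (swap-other a b x[r]≢a x[r]≢b)))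
                       B≤x[r])

  PrefixReaches-≤B : IsPerm x → IsOnto x → x ≤B y → PrefixReaches A B x → PrefixReaches A B y
  PrefixReaches-≤B _ _ ε reached = reached
  PrefixReaches-≤B {x = x} x-perm x-onto (x→w ◅ w≤y) reached =
    PrefixReaches-≤B (IsPerm-edge x x→w x-perm) (IsOnto-edge x x→w x-onto) w≤y
                     (PrefixReaches-edge x x-perm x-onto x→w reached)

-- Diamonds

pattern bot   = false ∷ false ∷ []
pattern left  = true ∷ false ∷ []
pattern right = false ∷ true ∷ []
pattern top   = true ∷ true ∷ []

square : Perm n → Perm n → Perm n → Perm n → Subset 2 → Perm n
square b a₁ a₂ t bot = b
square b a₁ a₂ t left = a₁
square b a₁ a₂ t right = a₂
square b a₁ a₂ t top = t

square-IsCube : ∀ {v b a₁ a₂ t : Perm n} → Edge b a₁ → Edge b a₂ → Edge a₁ t → Edge a₂ t →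
  a₁ ≢ a₂ → e ≤B b → t ≤B v → IsCube v 2 (square b a₁ a₂ t)
square-IsCube {v = v} {b} {a₁} {a₂} {t} b→a₁ b→a₂ a₁→t a₂→t a₁≢a₂ e≤b t≤v =
  injective , in-interval , edges
  where
  b≢t : b ≢ t
  b≢t b≡t = ℕₚ.<-irrefl (cong len b≡t) (ℕₚ.<-trans (proj₂ b→a₁) (proj₂ a₁→t))
  injective : ∀ S T → square b a₁ a₂ t S ≡ square b a₁ a₂ t T → S ≡ T
  injective bot bot _ = refl
  injective bot left eq = ⊥-elim (edge⇒≢ b→a₁ eq)
  injective bot right eq = ⊥-elim (edge⇒≢ b→a₂ eq)
  injective bot top eq = ⊥-elim (b≢t eq)
  injective left bot eq = ⊥-elim (edge⇒≢ b→a₁ (sym eq))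
  injective left left _ = refl
  injective left right eq = ⊥-elim (a₁≢a₂ eq)
  injective left top eq = ⊥-elim (edge⇒≢ a₁→t eq)
  injective right bot eq = ⊥-elim (edge⇒≢ b→a₂ (sym eq))
  injective right left eq = ⊥-elim (a₁≢a₂ (sym eq))
  injective right right _ = refl
  injective right top eq = ⊥-elim (edge⇒≢ a₂→t eq)
  injective top bot eq = ⊥-elim (b≢t (sym eq))
  injective top left eq = ⊥-elim (edge⇒≢ a₁→t (sym eq))
  injective top right eq = ⊥-elim (edge⇒≢ a₂→t (sym eq))
  injective top top _ = refl
  in-interval : ∀ S → InInt v (square b a₁ a₂ t S)
  in-interval bot = e≤b , b→a₁ ◅ a₁→t ◅ t≤v
  in-interval left = e≤b ◅◅ (b→a₁ ◅ ε) , a₁→t ◅ t≤v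
  in-interval right = e≤b ◅◅ (b→a₂ ◅ ε) , a₂→t ◅ t≤v
  in-interval top = e≤b ◅◅ (b→a₁ ◅ a₁→t ◅ ε) , t≤v
  edges : ∀ S i → i ∉ S → Edge (square b a₁ a₂ t S) (square b a₁ a₂ t (⁅ i ⁆ ∪ S))
  edges bot zero _ = b→a₁
  edges bot (suc zero) _ = b→a₂
  edges left zero 0∉S = ⊥-elim (0∉S Vec.here)
  edges left (suc zero) _ = a₁→t
  edges right zero _ = a₂→t
  edges right (suc zero) 1∉S = ⊥-elim (1∉S (Vec.there Vec.here))
  edges top zero 0∉S = ⊥-elim (0∉S Vec.here)
  edges top (suc zero) 1∉S = ⊥-elim (1∉S (Vec.there Vec.here))

diamond-top∈I : ∀ {v z b a₁ a₂ t : Perm n} → DiamondClosed v z → IsCube v 2 (square b a₁ a₂ t) →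
  InI z b → InI z a₁ → InI z a₂ → InI z t
diamond-top∈I {z = z} {b} {a₁} {a₂} {t} closed cube b∈I a₁∈I a₂∈I = closed _ cube top below-top
  where
  below-top : ∀ S → S ≢ top → InI z (square b a₁ a₂ t S)
  below-top bot _ = b∈I
  below-top left _ = a₁∈I
  below-top right _ = a₂∈I
  below-top top S≢top = ⊥-elim (S≢top refl)

diamond-tops-agree : ∀ {v z b a₁ a₂ t t′ : Perm n} → HypercubeCluster v z b →
  Antichain v z b (a₁ ∷ a₂ ∷ []) →
  IsCube v 2 (square b a₁ a₂ t) → IsCube v 2 (square b a₁ a₂ t′) → t ≡ t′
diamond-tops-agree {v = v} {z} {b} {a₁} {a₂} cluster antichain cube cube′ =
  trans (unique _ (spans cube) top) (sym (unique _ (spans cube′) top))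
  where
  unique : ∀ ψ → CubeAt v b (a₁ ∷ a₂ ∷ []) ψ → ∀ S → ψ S ≡ proj₁ (cluster _ antichain) S
  unique = proj₂ (proj₂ (cluster _ antichain))
  spans : ∀ {t} → IsCube v 2 (square b a₁ a₂ t) → CubeAt v b (a₁ ∷ a₂ ∷ []) (square b a₁ a₂ t)
  spans cube = cube , refl , λ { zero → refl ; (suc zero) → refl }

pattern I = zero
pattern K = suc zero
pattern J = suc (suc zero)

Slot : Set
Slot = Fin 3

-- Permutations supported on {i, k, j} are described by their action on the slots Fin 3,
-- which ⟦_⟧ embeds order-preservingly.
module Triple {n : ℕ} (i k j : Fin n) (i<k : i < k) (k<j : k < j) where

  i<j : i < j
  i<j = ℕₚ.<-trans i<k k<j

  ⟦_⟧ : Slot → Fin n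
  ⟦ I ⟧ = i
  ⟦ K ⟧ = k
  ⟦ J ⟧ = j

  ⟦⟧-injective : ∀ {s t} → ⟦ s ⟧ ≡ ⟦ t ⟧ → s ≡ t
  ⟦⟧-injective {I} {I} _ = refl
  ⟦⟧-injective {I} {K} eq = ⊥-elim (Finₚ.<⇒≢ i<k eq)
  ⟦⟧-injective {I} {J} eq = ⊥-elim (Finₚ.<⇒≢ i<j eq)
  ⟦⟧-injective {K} {I} eq = ⊥-elim (Finₚ.<⇒≢ i<k (sym eq))
  ⟦⟧-injective {K} {K} _ = refl
  ⟦⟧-injective {K} {J} eq = ⊥-elim (Finₚ.<⇒≢ k<j eq)
  ⟦⟧-injective {J} {I} eq = ⊥-elim (Finₚ.<⇒≢ i<j (sym eq))
  ⟦⟧-injective {J} {K} eq = ⊥-elim (Finₚ.<⇒≢ k<j (sym eq))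
  ⟦⟧-injective {J} {J} _ = refl

  swap-⟦⟧ : ∀ s t u → swap ⟦ s ⟧ ⟦ t ⟧ ⟦ u ⟧ ≡ ⟦ swap s t u ⟧
  swap-⟦⟧ s t u with u ≟ s
  ... | yes refl = swap-fst ⟦ u ⟧ ⟦ t ⟧
  ... | no u≢s with u ≟ t
  ...   | yes refl = swap-snd ⟦ s ⟧ ⟦ u ⟧
  ...   | no u≢t = swap-other ⟦ s ⟧ ⟦ t ⟧ (u≢s ∘ ⟦⟧-injective) (u≢t ∘ ⟦⟧-injective)

  Outside : Fin n → Set
  Outside m = ∀ s → m ≢ ⟦ s ⟧

  slot-or-outside : ∀ m → (∃[ s ] m ≡ ⟦ s ⟧) ⊎ Outside m
  slot-or-outside m with m ≟ i | m ≟ k | m ≟ j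
  ... | yes m≡i | _ | _ = inj₁ (I , m≡i)
  ... | no _ | yes m≡k | _ = inj₁ (K , m≡k)
  ... | no _ | no _ | yes m≡j = inj₁ (J , m≡j)
  ... | no m≢i | no m≢k | no m≢j = inj₂ λ { I → m≢i ; K → m≢k ; J → m≢j }

  slotwise : {f g : Slot → Slot} → f I ≡ g I → f K ≡ g K → f J ≡ g J → ∀ s → f s ≡ g s
  slotwise eqI _ _ I = eqI
  slotwise _ eqK _ K = eqK
  slotwise _ _ eqJ J = eqJ

  record Maps (P : Perm n) (σ : Slot → Slot) : Set where
    field
      at : ∀ s → lookup P ⟦ s ⟧ ≡ ⟦ σ s ⟧
      fixes : ∀ m → Outside m → lookup P m ≡ m
  open Maps

  Maps-e : Maps e (λ s → s)
  Maps-e = record { at = λ s → lookup-e ⟦ s ⟧ ; fixes = λ m _ → lookup-e m }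

  Maps-tmul : ∀ {P σ} α β → Maps P σ → Maps (tmul ⟦ α ⟧ ⟦ β ⟧ P) (swap α β ∘ σ)
  Maps-tmul {P} {σ} α β maps = record
    { at = λ s → trans (lookup-tmul ⟦ α ⟧ ⟦ β ⟧ P ⟦ s ⟧)
                       (trans (cong (swap ⟦ α ⟧ ⟦ β ⟧) (at maps s)) (swap-⟦⟧ α β (σ s)))
    ; fixes = λ m out → trans (lookup-tmul ⟦ α ⟧ ⟦ β ⟧ P m)
                              (trans (cong (swap ⟦ α ⟧ ⟦ β ⟧) (fixes maps m out))
                                     (swap-other ⟦ α ⟧ ⟦ β ⟧ (out α) (out β)))
    }

  Maps-unique : ∀ {P Q σ τ} → Maps P σ → Maps Q τ → (∀ s → σ s ≡ τ s) → P ≡ Q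
  Maps-unique {P} {Q} mP mQ σ≗τ = lookup-ext P Q agree
    where
    agree : ∀ m → lookup P m ≡ lookup Q m
    agree m with slot-or-outside m
    ... | inj₁ (s , refl) = trans (at mP s) (trans (cong ⟦_⟧ (σ≗τ s)) (sym (at mQ s)))
    ... | inj₂ out = trans (fixes mP m out) (sym (fixes mQ m out))

  Maps-≢ : ∀ {P Q σ τ} → Maps P σ → Maps Q τ → ∀ s → σ s ≢ τ s → P ≢ Q
  Maps-≢ mP mQ s σs≢τs refl = σs≢τs (⟦⟧-injective (trans (sym (at mP s)) (at mQ s)))

  edge-between : ∀ {P Q σ τ} → IsPerm P → Maps P σ → Maps Q τ → ∀ s t →
    ⟦ s ⟧ < ⟦ t ⟧ → ⟦ σ s ⟧ < ⟦ σ t ⟧ → (∀ u → swap (σ s) (σ t) (σ u) ≡ τ u) → Edge P Q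
  edge-between {P} P-perm mP mQ s t s<t σs<σt eq =
    subst (Edge P) (Maps-unique (Maps-tmul _ _ mP) mQ eq)
          (ascending-edge P ⟦ s ⟧ ⟦ t ⟧ P-perm s<t (at mP s) (at mP t) σs<σt)

  PrefixReaches-Maps : ∀ {P σ} → Maps P σ → ∀ s → PrefixReaches ⟦ s ⟧ ⟦ σ s ⟧ P
  PrefixReaches-Maps mP s = reach ⟦ s ⟧ Finₚ.≤-refl (Finₚ.≤-reflexive (sym (at mP s)))

  ¬PrefixReaches-Maps : ∀ {P σ A B} → Maps P σ → A < B → (∀ s → ⟦ s ⟧ ≤ A → ⟦ σ s ⟧ < B) →
    ¬ PrefixReaches A B P
  ¬PrefixReaches-Maps {P} mP A<B slots-below (reach r r≤A B≤P[r]) with slot-or-outside r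
  ... | inj₁ (s , refl) = ℕₚ.<⇒≱ (slots-below s r≤A) (subst (_ ≤_) (at mP s) B≤P[r])
  ... | inj₂ out = ℕₚ.<⇒≱ (ℕₚ.≤-<-trans r≤A A<B) (subst (_ ≤_) (fixes mP r out) B≤P[r])

  tik tkj tij tij·tik tkj·tik : Perm n
  tik = transp i k
  tkj = transp k j
  tij = transp i j
  tij·tik = tmul i j tik
  tkj·tik = tmul k j tik

  maps-tik : Maps tik (swap I K)
  maps-tik = Maps-tmul I K Maps-e
  maps-tkj : Maps tkj (swap K J)
  maps-tkj = Maps-tmul K J Maps-e
  maps-tij : Maps tij (swap I J)
  maps-tij = Maps-tmul I J Maps-e
  maps-tij·tik : Maps tij·tik (swap I J ∘ swap I K)
  maps-tij·tik = Maps-tmul I J maps-tik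
  maps-tkj·tik : Maps tkj·tik (swap K J ∘ swap I K)
  maps-tkj·tik = Maps-tmul K J maps-tik

  tik-perm : IsPerm tik
  tik-perm = IsPerm-tmul i k e IsPerm-e
  tkj-perm : IsPerm tkj
  tkj-perm = IsPerm-tmul k j e IsPerm-e

  e→tik : Edge e tik
  e→tik = edge-between IsPerm-e Maps-e maps-tik I K i<k i<k (slotwise refl refl refl)
  e→tkj : Edge e tkj
  e→tkj = edge-between IsPerm-e Maps-e maps-tkj K J k<j k<j (slotwise refl refl refl)
  tik→tij·tik : Edge tik tij·tik
  tik→tij·tik = edge-between tik-perm maps-tik maps-tij·tik K J k<j i<j (slotwise refl refl refl)
  tik→tkj·tik : Edge tik tkj·tik
  tik→tkj·tik = edge-between tik-perm maps-tik maps-tkj·tik I J i<j k<j (slotwise refl refl refl)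
  tkj→tij·tik : Edge tkj tij·tik
  tkj→tij·tik = edge-between tkj-perm maps-tkj maps-tij·tik I J i<j i<k (slotwise refl refl refl)
  tkj→tkj·tik : Edge tkj tkj·tik
  tkj→tkj·tik = edge-between tkj-perm maps-tkj maps-tkj·tik I K i<k i<j (slotwise refl refl refl)
  tij·tik→tij : Edge tij·tik tij
  tij·tik→tij = edge-between (IsPerm-tmul i j tik tik-perm) maps-tij·tik maps-tij I K i<k k<j
                             (slotwise refl refl refl)
  tkj·tik→tij : Edge tkj·tik tij
  tkj·tik→tij = edge-between (IsPerm-tmul k j tik tik-perm) maps-tkj·tik maps-tij K J k<j i<k
                             (slotwise refl refl refl)

  tik≢tkj : tik ≢ tkj
  tik≢tkj = Maps-≢ maps-tik maps-tkj I λ ()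
  tij·tik≢tkj·tik : tij·tik ≢ tkj·tik
  tij·tik≢tkj·tik = Maps-≢ maps-tij·tik maps-tkj·tik I λ ()

  -- tik puts the value k at position i, while tkj keeps all positions ≤ i below k;
  -- symmetrically for position k and value j.
  tik≰tkj : ¬ tik ≤B tkj
  tik≰tkj tik≤tkj = ¬PrefixReaches-Maps maps-tkj i<k below
    (PrefixReaches-≤B tik-perm (IsOnto-tmul i k e IsOnto-e) tik≤tkj (PrefixReaches-Maps maps-tik I))
    where
    below : ∀ s → ⟦ s ⟧ ≤ i → ⟦ swap K J s ⟧ < k
    below I _ = i<k
    below K k≤i = ⊥-elim (ℕₚ.<⇒≱ i<k k≤i)
    below J j≤i = ⊥-elim (ℕₚ.<⇒≱ i<j j≤i)

  tkj≰tik : ¬ tkj ≤B tik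
  tkj≰tik tkj≤tik = ¬PrefixReaches-Maps maps-tik k<j below
    (PrefixReaches-≤B tkj-perm (IsOnto-tmul k j e IsOnto-e) tkj≤tik (PrefixReaches-Maps maps-tkj K))
    where
    below : ∀ s → ⟦ s ⟧ ≤ k → ⟦ swap I K s ⟧ < j
    below I _ = k<j
    below K _ = i<j
    below J j≤k = ⊥-elim (ℕₚ.<⇒≱ k<j j≤k)

  module Below (v : Perm n) (tij≤v : tij ≤B v) where

    lower₁ : IsCube v 2 (square e tik tkj tij·tik)
    lower₁ = square-IsCube e→tik e→tkj tik→tij·tik tkj→tij·tik tik≢tkj ε (tij·tik→tij ◅ tij≤v)

    lower₂ : IsCube v 2 (square e tik tkj tkj·tik)
    lower₂ = square-IsCube e→tik e→tkj tik→tkj·tik tkj→tkj·tik tik≢tkj ε (tkj·tik→tij ◅ tij≤v)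

    upper : IsCube v 2 (square tik tij·tik tkj·tik tij)
    upper = square-IsCube tik→tij·tik tik→tkj·tik tij·tik→tij tkj·tik→tij tij·tik≢tkj·tik
                          (e→tik ◅ ε) tij≤v

    tik∈[e,v] : InInt v tik
    tik∈[e,v] = proj₁ (proj₂ lower₁) left

    tkj∈[e,v] : InInt v tkj
    tkj∈[e,v] = proj₁ (proj₂ lower₁) right

    atoms∈I⇒tij∈I : ∀ {z} → DiamondClosed v z → InI z e → tik ≤B z → tkj ≤B z → InI z tij
    atoms∈I⇒tij∈I closed e∈I tik≤z tkj≤z =
      diamond-top∈I closed upper tik∈I (diamond-top∈I closed lower₁ e∈I tik∈I tkj∈I)
                                        (diamond-top∈I closed lower₂ e∈I tik∈I tkj∈I)
      where
      tik∈I : InI _ tik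
      tik∈I = e→tik ◅ ε , tik≤z
      tkj∈I : InI _ tkj
      tkj∈I = e→tkj ◅ ε , tkj≤z

    atoms∉I-impossible : ∀ {z} → HypercubeCluster v z e → ¬ tik ≤B z → ¬ tkj ≤B z → ⊥
    atoms∉I-impossible {z} cluster tik≰z tkj≰z =
      tij·tik≢tkj·tik (diamond-tops-agree cluster antichain lower₁ lower₂)
      where
      antichain : Antichain v z e (tik ∷ tkj ∷ [])
      antichain =
        (tik∈[e,v] , tik≰z ∘ proj₂ , e→tik) ∷ᴬ (tkj∈[e,v] , tkj≰z ∘ proj₂ , e→tkj) ∷ᴬ []ᴬ ,
        ((tik≰tkj , tkj≰tik) ∷ᴬ []ᴬ) ∷ᴾ []ᴬ ∷ᴾ []ᴾ

lemma4p7 : (n : ℕ) (v : Perm n) → IsPerm v → (z : Perm n) → HypercubeDecomposition v z →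
    (i j : Fin n) → i < j → InY v z e (transp i j) →
    (k : Fin n) → i < k → k < j →
    (InY v z e (transp i k) × ¬ InY v z e (transp k j)) ⊎ (¬ InY v z e (transp i k) × InY v z e (transp k j))
lemma4p7 n v _ z (z∈[e,v] , closed , clusters) i j _ (tij∈[e,v] , tij∉I , _) k i<k k<j =
  exactly-one (tik ≤B? z) (tkj ≤B? z)
  where
  open Triple i k j i<k k<j
  open Below v (proj₂ tij∈[e,v])
  e∈I : InI z e
  e∈I = ε , proj₁ z∈[e,v]
  exactly-one : Dec (tik ≤B z) → Dec (tkj ≤B z) →
    (InY v z e tik × ¬ InY v z e tkj) ⊎ (¬ InY v z e tik × InY v z e tkj)
  exactly-one (yes tik≤z) (yes tkj≤z) = ⊥-elim (tij∉I (atoms∈I⇒tij∈I closed e∈I tik≤z tkj≤z))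
  exactly-one (yes tik≤z) (no tkj≰z) =
    inj₂ ((λ (_ , tik∉I , _) → tik∉I (e→tik ◅ ε , tik≤z)) , (tkj∈[e,v] , tkj≰z ∘ proj₂ , e→tkj))
  exactly-one (no tik≰z) (yes tkj≤z) =
    inj₁ ((tik∈[e,v] , tik≰z ∘ proj₂ , e→tik) , (λ (_ , tkj∉I , _) → tkj∉I (e→tkj ◅ ε , tkj≤z)))
  exactly-one (no tik≰z) (no tkj≰z) = ⊥-elim (atoms∉I-impossible (clusters e e∈I) tik≰z tkj≰z)
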